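{- Let $n,\Delta\in\mathbb{N}$ and $d\in\mathbb{R}^+$ with $d\ge2\Delta$. Then every $(n,d)$-expander is universal for $\mathcal{T}(n-4\Delta\, m(n,d),\Delta)$, i.e. it contains a copy of every tree on $n-4\Delta\,m(n,d)$ vertices with maximum degree at most $\Delta$.
   Context: For a graph $G$ and $X\subseteq V(G)$, $N_G(X)=\{y\in V(G)\setminus X:\exists x\in X,\{x,y\}\in E(G)\}$; $e_G(X,Y)$ counts ordered pairs $(x,y)\in X\times Y$ with $\{x,y\}\in E(G)$. $m(n,d)=\lceil n/(2d)\rceil$. A graph $G$ is an $(n,d)$-expander if $|V(G)|=n$, $|N_G(X)|\ge d|X|$ for all $X\subseteq V(G)$ with $1\le|X|<m(n,d)$, and $e_G(X,Y)>0$ for all disjoint $X,Y\subseteq V(G)$ with $|X|=|Y|=m(n,d)$. $\mathcal{T}(k,\Delta)$ is the class of $k$-vertex trees with maximum degree at most $\Delta$.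
   Formalization: The parameter d ranges over the positive rationals instead of the positive reals. -}

module Defs where

open import Data.Nat as ℕ using (ℕ; zero; suc; _+_; _∸_; _<_)
open import Data.Bool using (Bool; true; false; not; _∧_; _∨_)
open import Data.Fin using (Fin; zero; suc)
open import Data.Fin.Subset using (Subset; ∣_∣; _∈_; _∉_; Empty)
open import Data.Vec using (Vec; []; _∷_; tabulate; lookup)
open import Data.Integer as ℤ using (+_)
open import Data.Rational as ℚ using (ℚ; Positive; _/_; 1/_; ceiling)
open import Data.Rational.Properties using (pos⇒nonZero)
open import Data.List using (List; []; _∷_)
open import Data.List.Relation.Unary.Unique.Propositional using (Unique)
open import Data.Product using (Σ; ∃; _×_; _,_)
open import Relation.Binary.PropositionalEquality using (_≡_)
open import Function.Definitions using (Injective)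
open import Relation.Nullary using (¬_)

record Graph (n : ℕ) : Set where
  field
    adj    : Fin n → Fin n → Bool
    sym    : ∀ x y → adj x y ≡ adj y x
    irrefl : ∀ x → adj x x ≡ false
open Graph public

anyFin : ∀ {n} → (Fin n → Bool) → Bool
anyFin {zero}  f = false
anyFin {suc n} f = f zero ∨ anyFin (λ i → f (suc i))

sumFin : ∀ {n} → (Fin n → ℕ) → ℕ
sumFin {zero}  f = 0
sumFin {suc n} f = f zero + sumFin (λ i → f (suc i))

N : ∀ {n} → Graph n → Subset n → Subset n
N G X = tabulate λ y → not (lookup X y) ∧ anyFin (λ x → lookup X x ∧ adj G x y)

e : ∀ {n} → Graph n → Subset n → Subset n → ℕ
e G X Y = sumFin λ x → ∣ tabulate (λ y → lookup X x ∧ lookup Y y ∧ adj G x y) ∣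

Disjoint : ∀ {n} → Subset n → Subset n → Set
Disjoint {n} X Y = ∀ (x : Fin n) → x ∈ X → x ∉ Y

ℕ→ℚ : ℕ → ℚ
ℕ→ℚ k = (+ k) / 1

-- m(n,d) = ⌈ n / (2d) ⌉   (a natural number since n/(2d) ≥ 0)
m : ℕ → (d : ℚ) → .{{_ : Positive d}} → ℕ
m n d = ℤ.∣_∣ (ceiling (((+ n) / 2) ℚ.* (1/ d) {{pos⇒nonZero d}}))

IsExpander : (n : ℕ) (d : ℚ) .{{_ : Positive d}} → Graph n → Set
IsExpander n d G =
  (∀ (X : Subset n) → 1 ℕ.≤ ∣ X ∣ → ∣ X ∣ < m n d →
      d ℚ.* ℕ→ℚ ∣ X ∣ ℚ.≤ ℕ→ℚ ∣ N G X ∣)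
  × (∀ (X Y : Subset n) → Disjoint X Y → ∣ X ∣ ≡ m n d → ∣ Y ∣ ≡ m n d →
      0 < e G X Y)

deg : ∀ {k} → Graph k → Fin k → ℕ
deg G v = ∣ tabulate (adj G v) ∣

MaxDegreeAtMost : ∀ {k} → Graph k → ℕ → Set
MaxDegreeAtMost {k} G Δ = ∀ (v : Fin k) → deg G v ℕ.≤ Δ

data Walk {k} (G : Graph k) : Fin k → Fin k → Set where
  here  : ∀ {u} → Walk G u u
  there : ∀ {u w v} → adj G u w ≡ true → Walk G w v → Walk G u v

Connected : ∀ {k} → Graph k → Set
Connected {k} G = ∀ (u v : Fin k) → Walk G u v

data Path {k} (G : Graph k) : List (Fin k) → Set where
  single : ∀ {v} → Path G (v ∷ [])
  step   : ∀ {u w vs} → adj G u w ≡ true → Path G (w ∷ vs) → Path G (u ∷ w ∷ vs)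

-- a cycle: distinct vertices v₀ v₁ … v_l with l ≥ 2, consecutive ones adjacent
-- and v_l adjacent to v₀
HasCycle : ∀ {k} → Graph k → Set
HasCycle {k} G =
  Σ (Fin k) λ v₀ → Σ (Fin k) λ v₁ → Σ (List (Fin k)) λ rest → Σ (Fin k) λ vₗ →
    let vs = v₀ ∷ v₁ ∷ Data.List._++_ rest (vₗ ∷ []) in
    Unique vs × Path G vs × adj G vₗ v₀ ≡ true

IsTree : ∀ {k} → Graph k → Set
IsTree G = Connected G × ¬ HasCycle G

ContainsCopy : ∀ {n k} → Graph n → Graph k → Set
ContainsCopy {n} {k} G T =
  Σ (Fin k → Fin n) λ f → Injective _≡_ _≡_ f ×
    (∀ u v → adj T u v ≡ true → adj G (f u) (f v) ≡ true)

{-# OPTIONS --safe #-}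

-- A greedy embedding in the style of Friedman and Pippenger.  The tree is
-- embedded one vertex at a time; besides the partial embedding f we keep the
-- set W of used vertices of G and a demand b : V(G) → ℕ with b ≤ Δ, b = Δ off W,
-- and b (f u) at least the number of neighbours of u still to be embedded.  The
-- invariant is the Hall-type condition b(X) ≤ |N(X) ∖ W| for 1 ≤ |X| < m.
-- While |W| + 4Δm < n it holds strictly, for free, when m ≤ |X| ≤ 2m: the second
-- expander property leaves fewer than m vertices outside X ∪ N(X), and Δ ≥ 2
-- gives (Δ + 1)·2m + m ≤ 4Δm.  Hence sets of size < m attaining equality (tight
-- sets) are closed under union, by submodularity of X ↦ |N(X) ∖ W|.  To embed a
-- new child of u, take a largest tight set U avoiding s = f u.  As b(s) ≥ 1 and
-- the invariant holds for U ∪ {s}, N(U ∪ {s}) ∖ W exceeds N(U) ∖ W, so some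
-- y ∈ N(s) ∖ W has no neighbour in U, hence none in any tight set avoiding s
-- (all of which lie in U).  Adding y to W while lowering b(s) and b(y) by one
-- then preserves the invariant.  A connected graph of maximum degree at most 1
-- has at most two vertices, which settles Δ ≤ 1.

module Submission where

open import Defs
open import Data.Nat as ℕ using (ℕ; zero; suc; _+_; _*_; _∸_; _≤_; _<_; z≤n; s≤s)
import Data.Nat.Properties as ℕP
open import Data.Nat.Tactic.RingSolver using (solve-∀)
open import Algebra.Bundles using (CommutativeMonoid)
import Algebra.Properties.CommutativeSemigroup as CommSemigroupProperties
open import Data.Bool as Bool using (Bool; true; false; not; _∧_; _∨_; if_then_else_)
import Data.Bool.Properties as BoolP
open import Data.Fin as Fin using (Fin; zero; suc; _≟_)
import Data.Fin.Properties as FinP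
open import Data.Fin.Subset using (Subset; ∣_∣)
open import Data.Fin.Subset.Properties using (anySubset?)
open import Data.Vec using (tabulate; lookup)
open import Data.Vec.Functional using (updateAt)
open import Data.Vec.Functional.Properties using (updateAt-updates; updateAt-minimal)
open import Data.Vec.Properties using (lookup∘tabulate; []=⇒lookup)
import Data.Integer as ℤ
import Data.Integer.Properties as ℤP
open import Data.Rational as ℚ using (ℚ; Positive; toℚᵘ)
import Data.Rational.Properties as ℚP
import Data.Rational.Unnormalised as ℚᵘ
import Data.Rational.Unnormalised.Properties as ℚᵘP
import Data.Nat.Coprimality as Coprimality
open import Data.List using (List; []; _∷_; _++_)
open import Data.List.Relation.Unary.All as All using (All; []; _∷_)
import Data.List.Relation.Unary.All.Properties as All
open import Data.List.Relation.Unary.AllPairs using ([]; _∷_)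
import Data.List.Relation.Unary.AllPairs.Properties as AllPairs
open import Data.List.Relation.Unary.Unique.Propositional using (Unique)
open import Data.Product using (Σ; ∃; ∃₂; _×_; _,_; proj₁; proj₂)
open import Data.Sum using (_⊎_; inj₁; inj₂)
open import Data.Empty using (⊥; ⊥-elim)
open import Function using (_∘_; case_of_)
open import Relation.Nullary using (¬_; Dec; yes; no; does)
open import Relation.Nullary.Decidable using (_×-dec_)
open import Relation.Binary.PropositionalEquality as ≡
  using (_≡_; _≢_; refl; trans; cong; cong₂; subst; subst₂)

private
  variable
    n k : ℕ

open CommSemigroupProperties ℕP.+-commutativeSemigroup
  using () renaming (interchange to +-interchange)
open CommSemigroupProperties (CommutativeMonoid.commutativeSemigroup BoolP.∨-commutativeMonoid)
  using () renaming (interchange to ∨-interchange)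

-- Finite sets

-- Subsets of Fin n as characteristic functions rather than `Subset` vectors,
-- so that set algebra computes pointwise.
Sub : ℕ → Set
Sub n = Fin n → Bool

infix 4 _≐_ _⊆_
infixr 6 _∪_ _∩_ _∖_

_≐_ : Sub n → Sub n → Set
X ≐ Y = ∀ i → X i ≡ Y i

_⊆_ : Sub n → Sub n → Set
X ⊆ Y = ∀ i → X i ≡ true → Y i ≡ true

∅ : Sub n
∅ _ = false

full : Sub n
full _ = true

-- `does` rather than ⌊_⌋, so that ⁅ suc y ⁆ (suc i) reduces to ⁅ y ⁆ i.
⁅_⁆ : Fin n → Sub n
⁅ y ⁆ i = does (i ≟ y)

_∪_ _∩_ _∖_ : Sub n → Sub n → Sub n
(X ∪ Y) i = X i ∨ Y i
(X ∩ Y) i = X i ∧ Y i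
(X ∖ Y) i = not (Y i) ∧ X i

bit : Bool → ℕ
bit true  = 1
bit false = 0

size : Sub n → ℕ
size X = sumFin (λ i → bit (X i))

weight : (Fin n → ℕ) → Sub n → ℕ
weight b X = sumFin (λ i → if X i then b i else 0)

true≢false : true ≢ false
true≢false ()

∧-true : ∀ {a b} → a ∧ b ≡ true → a ≡ true × b ≡ true
∧-true {true} {true} _ = refl , refl

∨-false : ∀ {a b} → a ∨ b ≡ false → a ≡ false × b ≡ false
∨-false {false} {false} _ = refl , refl

not-true : ∀ {a} → not a ≡ true → a ≡ false
not-true {false} _ = refl

⁅⁆-self : (y : Fin n) → ⁅ y ⁆ y ≡ true
⁅⁆-self y with y ≟ y
... | yes _ = refl
... | no y≢y = ⊥-elim (y≢y refl)

⁅⁆⇒≡ : {x y : Fin n} → ⁅ y ⁆ x ≡ true → x ≡ y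
⁅⁆⇒≡ {x = x} {y} e with x ≟ y
... | yes x≡y = x≡y

≢⇒∉⁅⁆ : {x y : Fin n} → x ≢ y → ⁅ y ⁆ x ≡ false
≢⇒∉⁅⁆ {x = x} {y} x≢y with x ≟ y
... | yes x≡y = ⊥-elim (x≢y x≡y)
... | no _    = refl

∪⁅⁆-new : (X : Sub n) (y : Fin n) → (X ∪ ⁅ y ⁆) y ≡ true
∪⁅⁆-new X y = trans (cong (X y ∨_) (⁅⁆-self y)) (BoolP.∨-zeroʳ (X y))

⊆∪⁅⁆ : (X : Sub n) (y : Fin n) → X ⊆ X ∪ ⁅ y ⁆
⊆∪⁅⁆ X y i Xi = cong (_∨ ⁅ y ⁆ i) Xi

∪⁅⁆-cases : (X : Sub n) {x y : Fin n} → (X ∪ ⁅ y ⁆) x ≡ true → X x ≡ true ⊎ x ≡ y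
∪⁅⁆-cases X {x} X∪y with X x
... | true  = inj₁ refl
... | false = inj₂ (⁅⁆⇒≡ X∪y)

∉⇒≢ : {X : Sub n} {x y : Fin n} → X x ≡ true → X y ≡ false → x ≢ y
∉⇒≢ Xx Xy refl = true≢false (trans (≡.sym Xx) Xy)

∉⇒∩⁅⁆≐∅ : (X : Sub n) {y : Fin n} → X y ≡ false → X ∩ ⁅ y ⁆ ≐ ∅
∉⇒∩⁅⁆≐∅ X {y} Xy i with i ≟ y
... | yes refl = cong (_∧ true) Xy
... | no _     = BoolP.∧-zeroʳ (X i)

∈⇒∩⁅⁆≐⁅⁆ : (X : Sub n) {y : Fin n} → X y ≡ true → X ∩ ⁅ y ⁆ ≐ ⁅ y ⁆
∈⇒∩⁅⁆≐⁅⁆ X {y} Xy i with i ≟ y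
... | yes refl = cong (_∧ true) Xy
... | no _     = BoolP.∧-zeroʳ (X i)

sumFin-cong : {f g : Fin n → ℕ} → (∀ i → f i ≡ g i) → sumFin f ≡ sumFin g
sumFin-cong {zero}  f≗g = refl
sumFin-cong {suc n} f≗g = cong₂ _+_ (f≗g zero) (sumFin-cong (λ i → f≗g (suc i)))

sumFin-mono : {f g : Fin n → ℕ} → (∀ i → f i ≤ g i) → sumFin f ≤ sumFin g
sumFin-mono {zero}  f≤g = z≤n
sumFin-mono {suc n} f≤g = ℕP.+-mono-≤ (f≤g zero) (sumFin-mono (λ i → f≤g (suc i)))

sumFin-+ : (f g : Fin n → ℕ) → sumFin (λ i → f i + g i) ≡ sumFin f + sumFin g
sumFin-+ {zero}  f g = refl
sumFin-+ {suc n} f g =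
  trans (cong (f zero + g zero +_) (sumFin-+ (λ i → f (suc i)) (λ i → g (suc i))))
        (+-interchange (f zero) (g zero) _ _)

sumFin-*ˡ : (c : ℕ) (f : Fin n → ℕ) → sumFin (λ i → c * f i) ≡ c * sumFin f
sumFin-*ˡ {zero}  c f = ≡.sym (ℕP.*-zeroʳ c)
sumFin-*ˡ {suc n} c f =
  trans (cong (c * f zero +_) (sumFin-*ˡ c (λ i → f (suc i))))
        (≡.sym (ℕP.*-distribˡ-+ c (f zero) _))

sumFin-positive : (f : Fin n → ℕ) → 0 < sumFin f → ∃ λ i → 0 < f i
sumFin-positive {suc n} f 0<Σ with f zero in eq
... | suc _ = zero , subst (0 <_) (≡.sym eq) (s≤s z≤n)
... | zero  with sumFin-positive (λ i → f (suc i)) 0<Σ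
...   | i , 0<fi = suc i , 0<fi

sumFin-pairwise-≤ : (f g h l : Fin n → ℕ) → (∀ i → f i + g i ≤ h i + l i) →
                    sumFin f + sumFin g ≤ sumFin h + sumFin l
sumFin-pairwise-≤ f g h l pointwise =
  subst₂ _≤_ (sumFin-+ f g) (sumFin-+ h l) (sumFin-mono pointwise)

sumFin-pairwise-≡ : (f g h l : Fin n → ℕ) → (∀ i → f i + g i ≡ h i + l i) →
                    sumFin f + sumFin g ≡ sumFin h + sumFin l
sumFin-pairwise-≡ f g h l pointwise =
  trans (≡.sym (sumFin-+ f g)) (trans (sumFin-cong pointwise) (sumFin-+ h l))

size-cong : {X Y : Sub n} → X ≐ Y → size X ≡ size Y
size-cong X≐Y = sumFin-cong (λ i → cong bit (X≐Y i))

size-∅ : size (∅ {n}) ≡ 0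
size-∅ {zero}  = refl
size-∅ {suc n} = size-∅ {n}

size-full : size (full {n}) ≡ n
size-full {zero}  = refl
size-full {suc n} = cong suc (size-full {n})

size-⁅⁆ : (y : Fin n) → size ⁅ y ⁆ ≡ 1
size-⁅⁆ {suc n} zero    = cong suc (size-∅ {n})
size-⁅⁆ {suc n} (suc y) = size-⁅⁆ y

bit-mono : ∀ {a b} → (a ≡ true → b ≡ true) → bit a ≤ bit b
bit-mono {false} _   = z≤n
bit-mono {true}  a⇒b rewrite a⇒b refl = ℕP.≤-refl

size-mono : {X Y : Sub n} → X ⊆ Y → size X ≤ size Y
size-mono X⊆Y = sumFin-mono (λ i → bit-mono (X⊆Y i))

size≤n : (X : Sub n) → size X ≤ n
size≤n {n} X = subst (size X ≤_) (size-full {n}) (size-mono {X = X} {Y = full} (λ _ _ → refl))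

size-mono-< : {X Y : Sub n} → X ⊆ Y → (i : Fin n) → Y i ≡ true → X i ≡ false → size X < size Y
size-mono-< X⊆Y zero    Yi Xi rewrite Yi | Xi = s≤s (size-mono (λ i → X⊆Y (suc i)))
size-mono-< X⊆Y (suc i) Yi Xi =
  ℕP.+-mono-≤-< (bit-mono (X⊆Y zero)) (size-mono-< (λ j → X⊆Y (suc j)) i Yi Xi)

size-positive : (X : Sub n) → 0 < size X → ∃ λ i → X i ≡ true
size-positive X 0<size with sumFin-positive (λ i → bit (X i)) 0<size
... | i , 0<bit = i , positive-bit 0<bit
  where
  positive-bit : ∀ {a} → 0 < bit a → a ≡ true
  positive-bit {true} _ = refl

size-modular : (X Y : Sub n) → size (X ∪ Y) + size (X ∩ Y) ≡ size X + size Y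
size-modular X Y = sumFin-pairwise-≡ _ _ _ _ (λ i → bit-modular (X i) (Y i))
  where
  bit-modular : ∀ a b → bit (a ∨ b) + bit (a ∧ b) ≡ bit a + bit b
  bit-modular true  true  = refl
  bit-modular true  false = refl
  bit-modular false b     = ℕP.+-identityʳ (bit b)

size-∪-⁅⁆ : (X : Sub n) {y : Fin n} → X y ≡ false → size (X ∪ ⁅ y ⁆) ≡ suc (size X)
size-∪-⁅⁆ {n} X {y} Xy = begin
  size (X ∪ ⁅ y ⁆)                        ≡⟨ ℕP.+-identityʳ _ ⟨
  size (X ∪ ⁅ y ⁆) + 0
    ≡⟨ cong (size (X ∪ ⁅ y ⁆) +_) (trans (size-cong (∉⇒∩⁅⁆≐∅ X Xy)) (size-∅ {n})) ⟨
  size (X ∪ ⁅ y ⁆) + size (X ∩ ⁅ y ⁆)     ≡⟨ size-modular X ⁅ y ⁆ ⟩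
  size X + size ⁅ y ⁆                     ≡⟨ cong (size X +_) (size-⁅⁆ y) ⟩
  size X + 1                              ≡⟨ ℕP.+-comm (size X) 1 ⟩
  suc (size X)                            ∎
  where open ≡.≡-Reasoning

size≤size∖+size : (X Y : Sub n) → size X ≤ size (X ∖ Y) + size Y
size≤size∖+size {n} X Y =
  subst (size X ≤_) (sumFin-+ {n} (λ i → bit ((X ∖ Y) i)) (λ i → bit (Y i)))
        (sumFin-mono (λ i → bit-split (X i) (Y i)))
  where
  bit-split : ∀ a b → bit a ≤ bit (not b ∧ a) + bit b
  bit-split a     true  = subst (bit a ≤_) (ℕP.+-comm 1 0) (bit-mono {b = true} (λ _ → refl))
  bit-split true  false = ℕP.≤-refl
  bit-split false false = z≤n

size-<⇒∃∖ : (X Y : Sub n) → size Y < size X → ∃ λ i → X i ≡ true × Y i ≡ false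
size-<⇒∃∖ X Y Y<X
  with size-positive (X ∖ Y) (ℕP.+-cancelʳ-< (size Y) 0 _ (ℕP.<-≤-trans Y<X (size≤size∖+size X Y)))
... | i , X∖Yi = i , proj₂ (∧-true X∖Yi) , not-true (proj₁ (∧-true X∖Yi))

size<n⇒∃∉ : (X : Sub n) → size X < n → ∃ λ i → X i ≡ false
size<n⇒∃∉ {n} X X<n with size-<⇒∃∖ full X (subst (size X <_) (≡.sym (size-full {n})) X<n)
... | i , _ , Xi = i , Xi

size≡n⇒full : (X : Sub n) → size X ≡ n → ∀ i → X i ≡ true
size≡n⇒full {n} X X≡n i with X i in Xi
... | true  = refl
... | false = ⊥-elim (ℕP.<-irrefl (trans X≡n (≡.sym (size-full {n})))
                        (size-mono-< {Y = full} (λ _ _ → refl) i refl Xi))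

⊆∧size-≥⇒⊇ : {X Y : Sub n} → X ⊆ Y → size Y ≤ size X → Y ⊆ X
⊆∧size-≥⇒⊇ {X = X} X⊆Y Y≤X i Yi with X i in Xi
... | true  = refl
... | false = ⊥-elim (ℕP.<-irrefl refl (ℕP.<-≤-trans (size-mono-< X⊆Y i Yi Xi) Y≤X))

⊆-of-size : (X : Sub n) (c : ℕ) → c ≤ size X → ∃ λ Y → Y ⊆ X × size Y ≡ c
⊆-of-size {zero}  X zero    _ = ∅ , (λ ()) , refl
⊆-of-size {suc n} X c       c≤X with X zero in X0
⊆-of-size {suc n} X zero    _   | true = ∅ , (λ _ ()) , size-∅ {suc n}
⊆-of-size {suc n} X (suc c) c≤X | true with ⊆-of-size (λ i → X (suc i)) c (ℕP.≤-pred c≤X)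
... | Y , Y⊆X , Y≡c =
  (λ { zero → true ; (suc i) → Y i }) , (λ { zero _ → X0 ; (suc i) → Y⊆X i }) , cong suc Y≡c
⊆-of-size {suc n} X c       c≤X | false with ⊆-of-size (λ i → X (suc i)) c c≤X
... | Y , Y⊆X , Y≡c =
  (λ { zero → false ; (suc i) → Y i }) , (λ { zero () ; (suc i) → Y⊆X i }) , Y≡c

size-∩-⁅⁆ : (X : Sub n) (s : Fin n) → size (X ∩ ⁅ s ⁆) ≡ bit (X s)
size-∩-⁅⁆ {n} X s with X s in Xs
... | true  = trans (size-cong (∈⇒∩⁅⁆≐⁅⁆ X Xs)) (size-⁅⁆ s)
... | false = trans (size-cong (∉⇒∩⁅⁆≐∅ X Xs)) (size-∅ {n})

weight-cong : (b : Fin n → ℕ) {X Y : Sub n} → X ≐ Y → weight b X ≡ weight b Y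
weight-cong b X≐Y = sumFin-cong (λ i → cong (λ x → if x then b i else 0) (X≐Y i))

weight-mono : {b c : Fin n → ℕ} → (∀ x → b x ≤ c x) → (X : Sub n) → weight b X ≤ weight c X
weight-mono b≤c X = sumFin-mono pointwise
  where
  pointwise : ∀ i → (if X i then _ else 0) ≤ (if X i then _ else 0)
  pointwise i with X i
  ... | true  = b≤c i
  ... | false = z≤n

weight-const : (c : ℕ) (X : Sub n) → weight (λ _ → c) X ≡ c * size X
weight-const c X = trans (sumFin-cong pointwise) (sumFin-*ˡ c (λ i → bit (X i)))
  where
  pointwise : ∀ i → (if X i then c else 0) ≡ c * bit (X i)
  pointwise i with X i
  ... | true  = ≡.sym (ℕP.*-identityʳ c)
  ... | false = ≡.sym (ℕP.*-zeroʳ c)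

weight-∅ : (b : Fin n → ℕ) → weight b ∅ ≡ 0
weight-∅ {zero}  b = refl
weight-∅ {suc n} b = weight-∅ (λ i → b (suc i))

weight-⁅⁆ : (b : Fin n → ℕ) (y : Fin n) → weight b ⁅ y ⁆ ≡ b y
weight-⁅⁆ {suc n} b zero    = trans (cong (b zero +_) (weight-∅ (λ i → b (suc i)))) (ℕP.+-identityʳ (b zero))
weight-⁅⁆ {suc n} b (suc y) = weight-⁅⁆ (λ i → b (suc i)) y

weight-modular : (b : Fin n → ℕ) (X Y : Sub n) →
                 weight b (X ∪ Y) + weight b (X ∩ Y) ≡ weight b X + weight b Y
weight-modular b X Y = sumFin-pairwise-≡ _ _ _ _ (λ i → pointwise (X i) (Y i) (b i))
  where
  pointwise : ∀ x y c → (if x ∨ y then c else 0) + (if x ∧ y then c else 0)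
                        ≡ (if x then c else 0) + (if y then c else 0)
  pointwise true  true  c = refl
  pointwise true  false c = refl
  pointwise false true  c = ℕP.+-comm c 0
  pointwise false false c = refl

weight-∪-⁅⁆ : (b : Fin n → ℕ) (X : Sub n) {y : Fin n} → X y ≡ false →
              weight b (X ∪ ⁅ y ⁆) ≡ weight b X + b y
weight-∪-⁅⁆ b X {y} Xy = begin
  weight b (X ∪ ⁅ y ⁆)                            ≡⟨ ℕP.+-identityʳ _ ⟨
  weight b (X ∪ ⁅ y ⁆) + 0
    ≡⟨ cong (weight b (X ∪ ⁅ y ⁆) +_) (trans (weight-cong b (∉⇒∩⁅⁆≐∅ X Xy)) (weight-∅ b)) ⟨
  weight b (X ∪ ⁅ y ⁆) + weight b (X ∩ ⁅ y ⁆)     ≡⟨ weight-modular b X ⁅ y ⁆ ⟩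
  weight b X + weight b ⁅ y ⁆                     ≡⟨ cong (weight b X +_) (weight-⁅⁆ b y) ⟩
  weight b X + b y                                ∎
  where open ≡.≡-Reasoning

weight-decrease : {b b′ : Fin n → ℕ} (s : Fin n) → (∀ x → b′ x + bit (⁅ s ⁆ x) ≤ b x) →
                  (X : Sub n) → weight b′ X + bit (X s) ≤ weight b X
weight-decrease {n} {b} {b′} s b′<b X =
  subst₂ _≤_ (cong (weight b′ X +_) (size-∩-⁅⁆ X s))
             (trans (cong (weight b X +_) (size-∅ {n})) (ℕP.+-identityʳ (weight b X)))
    (sumFin-pairwise-≤ _ (λ i → bit ((X ∩ ⁅ s ⁆) i)) _ (λ _ → 0) pointwise)
  where
  pointwise : ∀ i → (if X i then b′ i else 0) + bit (X i ∧ ⁅ s ⁆ i) ≤ (if X i then b i else 0) + 0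
  pointwise i with X i
  ... | true  = subst (_ ≤_) (≡.sym (ℕP.+-identityʳ (b i))) (b′<b i)
  ... | false = z≤n

∖-∪ : (A W Y : Sub n) → (A ∖ W) ∖ Y ≐ A ∖ (W ∪ Y)
∖-∪ A W Y i with W i | Y i
... | true  | true  = refl
... | true  | false = refl
... | false | y     = refl

size-∖-∪ : (A W Y : Sub n) → size (A ∖ W) ≤ size (A ∖ (W ∪ Y)) + size Y
size-∖-∪ A W Y =
  subst (λ z → size (A ∖ W) ≤ z + size Y) (size-cong (∖-∪ A W Y)) (size≤size∖+size (A ∖ W) Y)

size-∖-∪⁅⁆ : (A W : Sub n) (y : Fin n) → size (A ∖ W) ≤ size (A ∖ (W ∪ ⁅ y ⁆)) + 1
size-∖-∪⁅⁆ A W y =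
  subst (λ z → size (A ∖ W) ≤ size (A ∖ (W ∪ ⁅ y ⁆)) + z) (size-⁅⁆ y) (size-∖-∪ A W ⁅ y ⁆)

size-∖-∪⁅⁆-∉ : (A W : Sub n) {y : Fin n} → A y ≡ false → size (A ∖ W) ≤ size (A ∖ (W ∪ ⁅ y ⁆))
size-∖-∪⁅⁆-∉ A W {y} Ay = size-mono A∖W⊆
  where
  A∖W⊆ : A ∖ W ⊆ A ∖ (W ∪ ⁅ y ⁆)
  A∖W⊆ i A∖Wi with ∧-true {not (W i)} A∖Wi
  ... | ¬Wi , Ai rewrite not-true ¬Wi | ≢⇒∉⁅⁆ (∉⇒≢ {X = A} Ai Ay) = Ai

Respects≐ : (Sub n → Set) → Set
Respects≐ Q = ∀ {X Y} → X ≐ Y → Q X → Q Y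

largest : (Q : Sub n → Set) → Respects≐ Q → (∀ X → Dec (Q X)) → (X₀ : Sub n) → Q X₀ →
          ∃ λ U → Q U × (∀ X → Q X → size X ≤ size U)
largest {n} Q resp Q? X₀ QX₀ = climb n X₀ QX₀ (ℕP.m≤n+m n (size X₀))
  where
  climb : (fuel : ℕ) (U : Sub n) → Q U → n ≤ size U + fuel →
          ∃ λ U → Q U × (∀ X → Q X → size X ≤ size U)
  climb zero U QU n≤U =
    U , QU , λ X _ → ℕP.≤-trans (size≤n X) (subst (n ≤_) (ℕP.+-identityʳ _) n≤U)
  climb (suc fuel) U QU n≤U+fuel
    with anySubset? (λ p → Q? (lookup p) ×-dec (size U ℕ.<? size (lookup p)))
  ... | yes (p , Qp , U<p) =
    climb fuel (lookup p) Qp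
      (ℕP.≤-trans n≤U+fuel (subst (_≤ size (lookup p) + fuel) (≡.sym (ℕP.+-suc (size U) fuel))
                                   (ℕP.+-monoˡ-≤ fuel U<p)))
  ... | no no-larger = U , QU , λ X QX → ℕP.≮⇒≥ (λ U<X →
    no-larger (tabulate X , resp tabulated QX , subst (size U <_) (size-cong tabulated) U<X))
    where
    tabulated : {X : Sub n} → X ≐ lookup (tabulate X)
    tabulated {X} i = ≡.sym (lookup∘tabulate X i)

-- Neighbourhoods

anyFin-intro : (f : Sub n) (i : Fin n) → f i ≡ true → anyFin f ≡ true
anyFin-intro f zero    fi rewrite fi = refl
anyFin-intro f (suc i) fi with f zero
... | true  = refl
... | false = anyFin-intro (λ j → f (suc j)) i fi

anyFin-elim : (f : Sub n) → anyFin f ≡ true → ∃ λ i → f i ≡ true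
anyFin-elim {suc n} f any-f with f zero in f0
... | true  = zero , f0
... | false with anyFin-elim (λ j → f (suc j)) any-f
...   | i , fi = suc i , fi

anyFin-cong : {f g : Sub n} → f ≐ g → anyFin f ≡ anyFin g
anyFin-cong {zero}  f≐g = refl
anyFin-cong {suc n} f≐g = cong₂ _∨_ (f≐g zero) (anyFin-cong (λ i → f≐g (suc i)))

anyFin-∪ : (f g : Sub n) → anyFin (f ∪ g) ≡ anyFin f ∨ anyFin g
anyFin-∪ {zero}  f g = refl
anyFin-∪ {suc n} f g =
  trans (cong ((f zero ∨ g zero) ∨_) (anyFin-∪ (λ i → f (suc i)) (λ i → g (suc i))))
        (∨-interchange (f zero) (g zero) _ _)

anyFin-∅ : anyFin (∅ {n}) ≡ false
anyFin-∅ {zero}  = refl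
anyFin-∅ {suc n} = anyFin-∅ {n}

module _ (G : Graph n) where

  adjacentTo : Sub n → Sub n
  adjacentTo X y = anyFin (λ x → X x ∧ adj G x y)

  nbr : Sub n → Sub n
  nbr X y = not (X y) ∧ adjacentTo X y

  exterior : Sub n → Sub n
  exterior X y = not (X y) ∧ not (nbr X y)

  adjacentTo-intro : {X : Sub n} {x y : Fin n} → X x ≡ true → adj G x y ≡ true → adjacentTo X y ≡ true
  adjacentTo-intro {X} {x} {y} Xx xy = anyFin-intro (λ z → X z ∧ adj G z y) x (cong₂ _∧_ Xx xy)

  adjacentTo-elim : {X : Sub n} {y : Fin n} → adjacentTo X y ≡ true → ∃ λ x → X x ≡ true × adj G x y ≡ true
  adjacentTo-elim any-X with anyFin-elim _ any-X
  ... | x , Xx∧xy = x , ∧-true Xx∧xy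

  adjacentTo-mono : {X Y : Sub n} → X ⊆ Y → adjacentTo X ⊆ adjacentTo Y
  adjacentTo-mono X⊆Y y adj-X with adjacentTo-elim adj-X
  ... | x , Xx , xy = adjacentTo-intro (X⊆Y x Xx) xy

  adjacentTo-cong : {X Y : Sub n} → X ≐ Y → adjacentTo X ≐ adjacentTo Y
  adjacentTo-cong X≐Y y = anyFin-cong (λ x → cong (_∧ adj G x y) (X≐Y x))

  adjacentTo-∪ : (X Y : Sub n) (y : Fin n) → adjacentTo (X ∪ Y) y ≡ adjacentTo X y ∨ adjacentTo Y y
  adjacentTo-∪ X Y y =
    trans (anyFin-cong (λ x → BoolP.∧-distribʳ-∨ (adj G x y) (X x) (Y x)))
          (anyFin-∪ (λ x → X x ∧ adj G x y) (λ x → Y x ∧ adj G x y))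

  nbr-cong : {X Y : Sub n} → X ≐ Y → nbr X ≐ nbr Y
  nbr-cong X≐Y y = cong₂ (λ a b → not a ∧ b) (X≐Y y) (adjacentTo-cong X≐Y y)

  nbr-elim : {X : Sub n} {y : Fin n} → nbr X y ≡ true → ∃ λ x → X x ≡ true × adj G x y ≡ true
  nbr-elim {X} {y} Ny = adjacentTo-elim (proj₂ (∧-true {not (X y)} Ny))

  exterior⇒∉ : {X : Sub n} {y : Fin n} → exterior X y ≡ true → X y ≡ false
  exterior⇒∉ {X} {y} ext = not-true (proj₁ (∧-true {not (X y)} ext))

  exterior-isolated : (X : Sub n) {x y : Fin n} → exterior X y ≡ true → X x ≡ true → adj G x y ≡ true → ⊥
  exterior-isolated X {x} {y} ext Xx xy = true≢false (trans (≡.sym y∈N) (not-true (proj₂ (∧-true {not (X y)} ext))))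
    where
    y∈N : nbr X y ≡ true
    y∈N = cong₂ _∧_ (cong not (exterior⇒∉ {X = X} ext)) (adjacentTo-intro Xx xy)

  size-partition : (X : Sub n) → size X + size (nbr X) + size (exterior X) ≡ n
  size-partition X = begin
    size X + size (nbr X) + size (exterior X)
      ≡⟨ cong (_+ size (exterior X)) (sumFin-+ {n} (bit ∘ X) (bit ∘ nbr X)) ⟨
    sumFin (λ y → bit (X y) + bit (nbr X y)) + size (exterior X)
      ≡⟨ sumFin-+ {n} (λ y → bit (X y) + bit (nbr X y)) (bit ∘ exterior X) ⟨
    sumFin (λ y → bit (X y) + bit (nbr X y) + bit (exterior X y))
      ≡⟨ sumFin-cong (λ y → bit-partition (X y) (adjacentTo X y)) ⟩
    size (full {n})
      ≡⟨ size-full ⟩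
    n ∎
    where
    open ≡.≡-Reasoning
    bit-partition : ∀ a t → bit a + bit (not a ∧ t) + bit (not a ∧ not (not a ∧ t)) ≡ 1
    bit-partition true  t     = refl
    bit-partition false true  = refl
    bit-partition false false = refl

  nbr-submodular : (W X Y : Sub n) →
    size (nbr (X ∪ Y) ∖ W) + size (nbr (X ∩ Y) ∖ W) ≤ size (nbr X ∖ W) + size (nbr Y ∖ W)
  nbr-submodular W X Y = sumFin-pairwise-≤ _ _ _ _ pointwise
    where
    bit-submodular : ∀ w a b α β γ → (γ ≡ true → α ≡ true) → (γ ≡ true → β ≡ true) →
      bit (not w ∧ (not (a ∨ b) ∧ (α ∨ β))) + bit (not w ∧ (not (a ∧ b) ∧ γ))
        ≤ bit (not w ∧ (not a ∧ α)) + bit (not w ∧ (not b ∧ β))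
    bit-submodular true  a     b     α     β γ γ⇒α γ⇒β = z≤n
    bit-submodular false true  true  α     β γ γ⇒α γ⇒β = z≤n
    bit-submodular false true  false α     β γ γ⇒α γ⇒β = bit-mono γ⇒β
    bit-submodular false false true  α     β γ γ⇒α γ⇒β = subst (bit γ ≤_) (ℕP.+-comm 0 (bit α)) (bit-mono γ⇒α)
    bit-submodular false false false α     β true  γ⇒α γ⇒β rewrite γ⇒α refl | γ⇒β refl = ℕP.≤-refl
    bit-submodular false false false true  β false γ⇒α γ⇒β = ℕP.m≤m+n 1 (bit β)
    bit-submodular false false false false β false γ⇒α γ⇒β = ℕP.≤-reflexive (ℕP.+-identityʳ _)
    pointwise : ∀ y → bit ((nbr (X ∪ Y) ∖ W) y) + bit ((nbr (X ∩ Y) ∖ W) y)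
                      ≤ bit ((nbr X ∖ W) y) + bit ((nbr Y ∖ W) y)
    pointwise y rewrite adjacentTo-∪ X Y y =
      bit-submodular (W y) (X y) (Y y) (adjacentTo X y) (adjacentTo Y y) (adjacentTo (X ∩ Y) y)
        (adjacentTo-mono (λ i → proj₁ ∘ ∧-true) y) (adjacentTo-mono (λ i → proj₂ ∘ ∧-true) y)

-- Extending by one vertex

record Expanding (G : Graph n) (Δ m : ℕ) : Set where
  field
    m-positive     : 1 ≤ m
    expansion      : ∀ X → 1 ≤ size X → size X < m → 2 * Δ * size X ≤ size (nbr G X)
    exterior-small : ∀ X → m ≤ size X → size (exterior G X) < m

4Δm-bound : ∀ {Δ m c} → 2 ≤ Δ → c ≤ 2 * m → Δ * c + c + m ≤ 4 * Δ * m
4Δm-bound {suc (suc t)} {m} {c} (s≤s (s≤s _)) c≤2m = begin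
  (2 + t) * c + c + m                       ≡⟨ collect t c m ⟩
  (3 + t) * c + m                           ≤⟨ ℕP.+-monoˡ-≤ m (ℕP.*-monoʳ-≤ (3 + t) c≤2m) ⟩
  (3 + t) * (2 * m) + m                     ≤⟨ ℕP.m≤m+n _ (m + 2 * t * m) ⟩
  (3 + t) * (2 * m) + m + (m + 2 * t * m)   ≡⟨ expand t m ⟩
  4 * (2 + t) * m                           ∎
  where
  open ℕP.≤-Reasoning
  collect : ∀ t c m → (2 + t) * c + c + m ≡ (3 + t) * c + m
  collect = solve-∀
  expand : ∀ t m → (3 + t) * (2 * m) + m + (m + 2 * t * m) ≡ 4 * (2 + t) * m
  expand = solve-∀

-- Read x = |X|, w = |W|, e = |exterior X|, N = |N(X)| and N′ = |N(X) ∖ W|.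
medium-expansion-arith : ∀ {Δ m x w e N N′ n} → 2 ≤ Δ → x ≤ 2 * m → w + 4 * Δ * m < n →
  x + N + e ≡ n → N ≤ N′ + w → e < m → Δ * x < N′
medium-expansion-arith {Δ} {m} {x} {w} {e} {N} {N′} {n} 2≤Δ x≤2m room partition N≤N′+w e<m =
  ℕP.+-cancelʳ-< (x + w + m) (Δ * x) N′ (begin-strict
    Δ * x + (x + w + m)   ≡⟨ regroup (Δ * x) x w m ⟩
    Δ * x + x + m + w     ≤⟨ ℕP.+-monoˡ-≤ w (4Δm-bound 2≤Δ x≤2m) ⟩
    4 * Δ * m + w         ≡⟨ ℕP.+-comm (4 * Δ * m) w ⟩
    w + 4 * Δ * m         <⟨ room ⟩
    n                     ≡⟨ partition ⟨
    x + N + e             ≤⟨ ℕP.+-mono-≤ (ℕP.+-monoʳ-≤ x N≤N′+w) (ℕP.<⇒≤ e<m) ⟩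
    x + (N′ + w) + m      ≡⟨ regroup′ x N′ w m ⟩
    N′ + (x + w + m)      ∎)
  where
  open ℕP.≤-Reasoning
  regroup : ∀ a x w m → a + (x + w + m) ≡ a + x + m + w
  regroup = solve-∀
  regroup′ : ∀ x a w m → x + (a + w) + m ≡ a + (x + w + m)
  regroup′ = solve-∀

module Extension {G : Graph n} {Δ m : ℕ} (expanding : Expanding G Δ m) (2≤Δ : 2 ≤ Δ) where
  open Expanding expanding

  Good : Sub n → (Fin n → ℕ) → Set
  Good W b = ∀ X → 1 ≤ size X → size X < m → weight b X ≤ size (nbr G X ∖ W)

  module _ {W : Sub n} {b : Fin n → ℕ} (b≤Δ : ∀ x → b x ≤ Δ) (good : Good W b)
           (room : size W + 4 * Δ * m < n) where

    weight≤Δ*size : (X : Sub n) → weight b X ≤ Δ * size X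
    weight≤Δ*size X = ℕP.≤-trans (weight-mono b≤Δ X) (ℕP.≤-reflexive (weight-const Δ X))

    medium-strict : (X : Sub n) → m ≤ size X → size X ≤ 2 * m → weight b X < size (nbr G X ∖ W)
    medium-strict X m≤X X≤2m = ℕP.≤-<-trans (weight≤Δ*size X)
      (medium-expansion-arith 2≤Δ X≤2m room (size-partition G X)
         (size≤size∖+size (nbr G X) W) (exterior-small X m≤X))

    good-up-to-2m : (X : Sub n) → size X ≤ 2 * m → weight b X ≤ size (nbr G X ∖ W)
    good-up-to-2m X X≤2m with m ℕ.≤? size X
    ... | yes m≤X = ℕP.<⇒≤ (medium-strict X m≤X X≤2m)
    ... | no X≱m with size X in X≡
    ...   | zero  =
      ℕP.≤-trans (weight≤Δ*size X)
        (ℕP.≤-trans (ℕP.≤-reflexive (trans (cong (Δ *_) X≡) (ℕP.*-zeroʳ Δ))) z≤n)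
    ...   | suc _ = good X (subst (1 ≤_) (≡.sym X≡) (s≤s z≤n)) (subst (_< m) (≡.sym X≡) (ℕP.≰⇒> X≱m))

    Tight : Sub n → Set
    Tight X = size X < m × size (nbr G X ∖ W) ≤ weight b X

    tight-∪ : {X Y : Sub n} → Tight X → Tight Y → Tight (X ∪ Y)
    tight-∪ {X} {Y} (X<m , X-tight) (Y<m , Y-tight) = X∪Y<m , X∪Y-tight
      where
      X+Y≤2m : size X + size Y ≤ 2 * m
      X+Y≤2m = subst (size X + size Y ≤_) (cong (m +_) (≡.sym (ℕP.+-identityʳ m)))
                     (ℕP.+-mono-≤ (ℕP.<⇒≤ X<m) (ℕP.<⇒≤ Y<m))
      X∪Y≤2m : size (X ∪ Y) ≤ 2 * m
      X∪Y≤2m = ℕP.≤-trans (ℕP.m≤m+n _ _) (subst (_≤ 2 * m) (≡.sym (size-modular X Y)) X+Y≤2m)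
      X∩Y≤2m : size (X ∩ Y) ≤ 2 * m
      X∩Y≤2m = ℕP.≤-trans (ℕP.m≤n+m _ _) (subst (_≤ 2 * m) (≡.sym (size-modular X Y)) X+Y≤2m)
      X∪Y-tight : size (nbr G (X ∪ Y) ∖ W) ≤ weight b (X ∪ Y)
      X∪Y-tight = ℕP.+-cancelʳ-≤ (size (nbr G (X ∩ Y) ∖ W)) _ _ (begin
        size (nbr G (X ∪ Y) ∖ W) + size (nbr G (X ∩ Y) ∖ W)  ≤⟨ nbr-submodular G W X Y ⟩
        size (nbr G X ∖ W) + size (nbr G Y ∖ W)              ≤⟨ ℕP.+-mono-≤ X-tight Y-tight ⟩
        weight b X + weight b Y                              ≡⟨ weight-modular b X Y ⟨
        weight b (X ∪ Y) + weight b (X ∩ Y)                  ≤⟨ ℕP.+-monoʳ-≤ _ (good-up-to-2m (X ∩ Y) X∩Y≤2m) ⟩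
        weight b (X ∪ Y) + size (nbr G (X ∩ Y) ∖ W)          ∎)
        where open ℕP.≤-Reasoning
      X∪Y<m : size (X ∪ Y) < m
      X∪Y<m = ℕP.≰⇒> (λ m≤X∪Y → ℕP.<⇒≱ (medium-strict (X ∪ Y) m≤X∪Y X∪Y≤2m) X∪Y-tight)

    TightAvoiding : Fin n → Sub n → Set
    TightAvoiding s X = Tight X × X s ≡ false

    largest-tight-avoiding : (s : Fin n) →
      ∃ λ U → TightAvoiding s U × (∀ X → TightAvoiding s X → size X ≤ size U)
    largest-tight-avoiding s = largest (TightAvoiding s) respects decide ∅ ∅-tight
      where
      respects : Respects≐ (TightAvoiding s)
      respects {X} {Y} X≐Y ((X<m , X-tight) , Xs) =
        (subst (_< m) (size-cong X≐Y) X<m ,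
         subst₂ _≤_ (size-cong (λ i → cong (not (W i) ∧_) (nbr-cong G X≐Y i))) (weight-cong b X≐Y) X-tight) ,
        trans (≡.sym (X≐Y s)) Xs
      decide : ∀ X → Dec (TightAvoiding s X)
      decide X = ((size X ℕ.<? m) ×-dec (size (nbr G X ∖ W) ℕ.≤? weight b X)) ×-dec (X s Bool.≟ false)
      ∅-tight : TightAvoiding s ∅
      ∅-tight = (subst (_< m) (≡.sym (size-∅ {n})) m-positive ,
                 subst (_≤ weight b ∅) (≡.sym (trans (size-cong nbr-∅) (size-∅ {n}))) z≤n) , refl
        where
        nbr-∅ : nbr G ∅ ∖ W ≐ ∅
        nbr-∅ y rewrite anyFin-∅ {n} = BoolP.∧-zeroʳ (not (W y))

    module _ {s : Fin n} {U : Sub n} (U-tight : Tight U) (Us : U s ≡ false)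
             (maximal : ∀ X → TightAvoiding s X → size X ≤ size U) where

      tight-avoiding⊆largest : (X : Sub n) → TightAvoiding s X → X ⊆ U
      tight-avoiding⊆largest X (X-tight , Xs) i Xi =
        ⊆∧size-≥⇒⊇ U⊆X∪U (maximal (X ∪ U) (tight-∪ X-tight U-tight , cong₂ _∨_ Xs Us)) i (cong (_∨ U i) Xi)
        where
        U⊆X∪U : U ⊆ X ∪ U
        U⊆X∪U j Uj = trans (cong (X j ∨_) Uj) (BoolP.∨-zeroʳ (X j))

      escape : 1 ≤ b s → ∃ λ y → W y ≡ false × adj G s y ≡ true ×
                                (∀ X → TightAvoiding s X → adjacentTo G X y ≡ false)
      escape 1≤bs with size-<⇒∃∖ (nbr G (U ∪ ⁅ s ⁆) ∖ W) (nbr G U ∖ W) grows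
        where
        U∪s≤2m : size (U ∪ ⁅ s ⁆) ≤ 2 * m
        U∪s≤2m = ℕP.≤-trans (ℕP.≤-reflexive (size-∪-⁅⁆ U Us))
                            (ℕP.≤-trans (proj₁ U-tight) (ℕP.m≤m+n m (m + 0)))
        grows : size (nbr G U ∖ W) < size (nbr G (U ∪ ⁅ s ⁆) ∖ W)
        grows = begin-strict
          size (nbr G U ∖ W)             ≤⟨ proj₂ U-tight ⟩
          weight b U                     <⟨ ℕP.m<m+n (weight b U) 1≤bs ⟩
          weight b U + b s               ≡⟨ weight-∪-⁅⁆ b U Us ⟨
          weight b (U ∪ ⁅ s ⁆)           ≤⟨ good-up-to-2m (U ∪ ⁅ s ⁆) U∪s≤2m ⟩
          size (nbr G (U ∪ ⁅ s ⁆) ∖ W)   ∎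
          where open ℕP.≤-Reasoning
      ... | y , new , old with ∧-true {not (W y)} new
      ...   | ¬Wy , new′ with ∧-true {not (U y ∨ ⁅ s ⁆ y)} new′
      ...     | ¬U∪sy , adj-U∪s = y , Wy , adj-sy , isolated
        where
        Wy : W y ≡ false
        Wy = not-true ¬Wy
        ¬adj-U : adjacentTo G U y ≡ false
        ¬adj-U = subst₂ (λ w u → not w ∧ (not u ∧ adjacentTo G U y) ≡ false)
                        Wy (proj₁ (∨-false (not-true ¬U∪sy))) old
        adj-s : adjacentTo G ⁅ s ⁆ y ≡ true
        adj-s = subst (λ a → a ∨ adjacentTo G ⁅ s ⁆ y ≡ true) ¬adj-U
                      (trans (≡.sym (adjacentTo-∪ G U ⁅ s ⁆ y)) adj-U∪s)
        adj-sy : adj G s y ≡ true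
        adj-sy with adjacentTo-elim G adj-s
        ... | x , x∈s , xy = subst (λ z → adj G z y ≡ true) (⁅⁆⇒≡ x∈s) xy
        isolated : ∀ X → TightAvoiding s X → adjacentTo G X y ≡ false
        isolated X X-avoid with adjacentTo G X y in adj-X
        ... | false = refl
        ... | true  = trans (≡.sym (adjacentTo-mono G (tight-avoiding⊆largest X X-avoid) y adj-X)) ¬adj-U

    module _ {s y : Fin n} {b′ : Fin n → ℕ} (b′+s≤b : ∀ x → b′ x + bit (⁅ s ⁆ x) ≤ b x)
             (isolated : ∀ X → TightAvoiding s X → adjacentTo G X y ≡ false) where

      weight-b′≤b : (X : Sub n) → weight b′ X ≤ weight b X
      weight-b′≤b X = ℕP.≤-trans (ℕP.m≤m+n _ _) (weight-decrease s b′+s≤b X)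

      preserve : Good (W ∪ ⁅ y ⁆) b′
      preserve X 1≤X X<m with X s in Xs
      ... | true = ℕP.+-cancelʳ-≤ 1 _ _ (begin
        weight b′ X + 1                    ≡⟨ cong (λ a → weight b′ X + bit a) Xs ⟨
        weight b′ X + bit (X s)            ≤⟨ weight-decrease s b′+s≤b X ⟩
        weight b X                         ≤⟨ good X 1≤X X<m ⟩
        size (nbr G X ∖ W)                 ≤⟨ size-∖-∪⁅⁆ (nbr G X) W y ⟩
        size (nbr G X ∖ (W ∪ ⁅ y ⁆)) + 1   ∎)
        where open ℕP.≤-Reasoning
      ... | false with size (nbr G X ∖ W) ℕ.≤? weight b X
      ...   | yes X-tight = begin
        weight b′ X                        ≤⟨ weight-b′≤b X ⟩
        weight b X                         ≤⟨ good X 1≤X X<m ⟩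
        size (nbr G X ∖ W)                 ≤⟨ size-∖-∪⁅⁆-∉ (nbr G X) W y∉NX ⟩
        size (nbr G X ∖ (W ∪ ⁅ y ⁆))       ∎
        where
        open ℕP.≤-Reasoning
        y∉NX : nbr G X y ≡ false
        y∉NX = trans (cong (not (X y) ∧_) (isolated X ((X<m , X-tight) , Xs))) (BoolP.∧-zeroʳ (not (X y)))
      ...   | no X-loose = ℕP.+-cancelʳ-≤ 1 _ _ (begin
        weight b′ X + 1                    ≤⟨ ℕP.+-monoˡ-≤ 1 (weight-b′≤b X) ⟩
        weight b X + 1                     ≡⟨ ℕP.+-comm (weight b X) 1 ⟩
        suc (weight b X)                   ≤⟨ ℕP.≰⇒> X-loose ⟩
        size (nbr G X ∖ W)                 ≤⟨ size-∖-∪⁅⁆ (nbr G X) W y ⟩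
        size (nbr G X ∖ (W ∪ ⁅ y ⁆)) + 1   ∎)
        where open ℕP.≤-Reasoning

    extend : (s : Fin n) → 1 ≤ b s → ∃ λ y → W y ≡ false × adj G s y ≡ true ×
               (∀ {b′} → (∀ x → b′ x + bit (⁅ s ⁆ x) ≤ b x) → Good (W ∪ ⁅ y ⁆) b′)
    extend s 1≤bs with largest-tight-avoiding s
    ... | U , (U-tight , Us) , maximal with escape U-tight Us maximal 1≤bs
    ...   | y , Wy , sy , isolated = y , Wy , sy , λ b′+s≤b → preserve b′+s≤b isolated

  1≤Δ : 1 ≤ Δ
  1≤Δ = ℕP.≤-trans (s≤s z≤n) 2≤Δ

  good-initial : (x₀ : Fin n) → Good ⁅ x₀ ⁆ (λ _ → Δ)
  good-initial x₀ X 1≤X X<m = ℕP.+-cancelʳ-≤ 1 _ _ (begin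
    weight (λ _ → Δ) X + 1                        ≡⟨ cong (_+ 1) (weight-const Δ X) ⟩
    Δ * size X + 1                                ≤⟨ ℕP.+-monoʳ-≤ (Δ * size X) (ℕP.*-mono-≤ 1≤Δ 1≤X) ⟩
    Δ * size X + Δ * size X                       ≡⟨ double Δ (size X) ⟩
    2 * Δ * size X                                ≤⟨ expansion X 1≤X X<m ⟩
    size (nbr G X)                                ≤⟨ size≤size∖+size (nbr G X) ⁅ x₀ ⁆ ⟩
    size (nbr G X ∖ ⁅ x₀ ⁆) + size ⁅ x₀ ⁆         ≡⟨ cong (size (nbr G X ∖ ⁅ x₀ ⁆) +_) (size-⁅⁆ x₀) ⟩
    size (nbr G X ∖ ⁅ x₀ ⁆) + 1                   ∎)
    where
    open ℕP.≤-Reasoning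
    double : ∀ a c → a * c + a * c ≡ 2 * a * c
    double = solve-∀

-- Embedding trees

module _ (T : Graph k) where

  PathIn : Sub k → Fin k → Fin k → Set
  PathIn E a c = Σ (List (Fin k)) λ inner →
    Unique (a ∷ inner ++ c ∷ []) × Path T (a ∷ inner ++ c ∷ []) ×
    All (λ x → E x ≡ true) (a ∷ inner ++ c ∷ [])

  private
    all-≢ : {E : Sub k} {w : Fin k} {xs : List (Fin k)} →
            E w ≡ false → All (λ x → E x ≡ true) xs → All (w ≢_) xs
    all-≢ Ew = All.map (λ Ex w≡x → ∉⇒≢ Ex Ew (≡.sym w≡x))

    Path-∷ʳ : ∀ a inner c w → Path T (a ∷ inner ++ c ∷ []) → adj T c w ≡ true →
              Path T (a ∷ (inner ++ c ∷ []) ++ w ∷ [])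
    Path-∷ʳ a []          c w (step ac single) cw = step ac (step cw single)
    Path-∷ʳ a (x ∷ inner) c w (step ax p)      cw = step ax (Path-∷ʳ x inner c w p cw)

  PathIn-mono : {E E′ : Sub k} → E ⊆ E′ → {a c : Fin k} → PathIn E a c → PathIn E′ a c
  PathIn-mono E⊆E′ (inner , u , p , in-E) = inner , u , p , All.map (E⊆E′ _) in-E

  PathIn-edge : {E : Sub k} {a c : Fin k} → a ≢ c → E a ≡ true → E c ≡ true → adj T a c ≡ true → PathIn E a c
  PathIn-edge a≢c Ea Ec ac = [] , (a≢c ∷ []) ∷ [] ∷ [] , step ac single , Ea ∷ Ec ∷ []

  PathIn-∷ : {E : Sub k} {w a c : Fin k} → E w ≡ false → adj T w a ≡ true →
             PathIn E a c → PathIn (E ∪ ⁅ w ⁆) w c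
  PathIn-∷ {E} {w} {a} Ew wa (inner , u , p , in-E) =
    a ∷ inner , all-≢ Ew in-E ∷ u , step wa p ,
    ∪⁅⁆-new E w ∷ All.map (⊆∪⁅⁆ E w _) in-E

  PathIn-∷ʳ : {E : Sub k} {w a c : Fin k} → E w ≡ false → adj T c w ≡ true →
              PathIn E a c → PathIn (E ∪ ⁅ w ⁆) a w
  PathIn-∷ʳ {E} {w} {a} {c} Ew cw (inner , u , p , in-E) =
    inner ++ c ∷ [] ,
    AllPairs.++⁺ u ([] ∷ []) (All.map (λ w≢x → (w≢x ∘ ≡.sym) ∷ []) (all-≢ Ew in-E)) ,
    Path-∷ʳ a inner c w p cw ,
    All.∷ʳ⁺ (All.map (⊆∪⁅⁆ E w _) in-E) (∪⁅⁆-new E w)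

  PathIn⇒cycle : {E : Sub k} {w a c : Fin k} → E w ≡ false → adj T w a ≡ true → adj T c w ≡ true →
                 PathIn E a c → HasCycle T
  PathIn⇒cycle {w = w} {a} {c} Ew wa cw (inner , u , p , in-E) = w , a , inner , c , all-≢ Ew in-E ∷ u , step wa p , cw

  walk-leaves : (E : Sub k) {a c : Fin k} → Walk T a c → E a ≡ true → E c ≡ false →
                ∃₂ λ v w → E v ≡ true × E w ≡ false × adj T v w ≡ true
  walk-leaves E here                   Ea Ec = ⊥-elim (true≢false (trans (≡.sym Ea) Ec))
  walk-leaves E (there {w = x} ax walk) Ea Ec with E x in Ex
  ... | true  = walk-leaves E walk Ex Ec
  ... | false = _ , x , Ea , Ex , ax

module TreeEmbedding {G : Graph n} {T : Graph k} {Δ m : ℕ} (expanding : Expanding G Δ m) (2≤Δ : 2 ≤ Δ)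
  (room : k + 4 * Δ * m ≤ n) (connected : Connected T) (acyclic : ¬ HasCycle T)
  (max-degree : ∀ u → size (adj T u) ≤ Δ) where

  open Extension expanding 2≤Δ

  record Partial : Set where
    field
      dom           : Sub k
      f             : Fin k → Fin n
      used          : Sub n
      demand        : Fin n → ℕ
      root          : Fin k
      root∈dom      : dom root ≡ true
      f-injective   : ∀ u v → dom u ≡ true → dom v ≡ true → f u ≡ f v → u ≡ v
      f-edges       : ∀ u v → dom u ≡ true → dom v ≡ true → adj T u v ≡ true → adj G (f u) (f v) ≡ true
      f∈used        : ∀ u → dom u ≡ true → used (f u) ≡ true
      size-used     : size used ≡ size dom
      demand≤Δ      : ∀ x → demand x ≤ Δ
      demand-unused : ∀ x → used x ≡ false → demand x ≡ Δ
      good          : Good used demand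
      degree-bound  : ∀ u → dom u ≡ true → size (adj T u) ≤ demand (f u) + size (dom ∩ adj T u)
      dom-connected : ∀ u v → dom u ≡ true → dom v ≡ true → u ≢ v → PathIn T dom u v

  initial : Fin k → Fin n → Partial
  initial r x₀ = record
    { dom           = ⁅ r ⁆
    ; f             = λ _ → x₀
    ; used          = ⁅ x₀ ⁆
    ; demand        = λ _ → Δ
    ; root          = r
    ; root∈dom      = ⁅⁆-self r
    ; f-injective   = λ u v u∈ v∈ _ → trans (⁅⁆⇒≡ u∈) (≡.sym (⁅⁆⇒≡ v∈))
    ; f-edges       = λ u v u∈ v∈ uv → ⊥-elim (true≢false (trans (≡.sym uv)
                        (subst (λ z → adj T u z ≡ false) (trans (⁅⁆⇒≡ u∈) (≡.sym (⁅⁆⇒≡ v∈))) (irrefl T u))))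
    ; f∈used        = λ _ _ → ⁅⁆-self x₀
    ; size-used     = trans (size-⁅⁆ x₀) (≡.sym (size-⁅⁆ r))
    ; demand≤Δ      = λ _ → ℕP.≤-refl
    ; demand-unused = λ _ _ → refl
    ; good          = good-initial x₀
    ; degree-bound  = λ u _ → ℕP.≤-trans (max-degree u) (ℕP.m≤m+n Δ _)
    ; dom-connected = λ u v u∈ v∈ u≢v → ⊥-elim (u≢v (trans (⁅⁆⇒≡ u∈) (≡.sym (⁅⁆⇒≡ v∈))))
    }

  module _ (P : Partial) where
    open Partial P

    1≤demand : ∀ {v w} → dom v ≡ true → dom w ≡ false → adj T v w ≡ true → 1 ≤ demand (f v)
    1≤demand {v} {w} v∈ w∉ vw = ℕP.+-cancelʳ-< (size (dom ∩ adj T v)) 0 (demand (f v))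
      (ℕP.<-≤-trans (size-mono-< (λ x → proj₂ ∘ ∧-true) w vw (cong (_∧ adj T v w) w∉)) (degree-bound v v∈))

    room-left : ∀ {w} → dom w ≡ false → size used + 4 * Δ * m < n
    room-left {w} w∉ = ℕP.<-≤-trans (ℕP.+-monoˡ-< (4 * Δ * m) used<k) room
      where
      used<k : size used < k
      used<k = subst₂ _<_ (≡.sym size-used) (size-full {k})
                 (size-mono-< {Y = full} (λ _ _ → refl) w refl w∉)

  module Grow (P : Partial) {v w : Fin k} (v∈ : Partial.dom P v ≡ true) (w∉ : Partial.dom P w ≡ false)
              (vw : adj T v w ≡ true) {y : Fin n} (y∉used : Partial.used P y ≡ false)
              (sy : adj G (Partial.f P v) y ≡ true)
              (good-after : ∀ {b′} → (∀ x → b′ x + bit (⁅ Partial.f P v ⁆ x) ≤ Partial.demand P x) →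
                                     Good (Partial.used P ∪ ⁅ y ⁆) b′) where
    open Partial P

    s : Fin n
    s = f v

    dom′ : Sub k
    dom′ = dom ∪ ⁅ w ⁆

    used′ : Sub n
    used′ = used ∪ ⁅ y ⁆

    s≢y : s ≢ y
    s≢y = ∉⇒≢ {X = used} (f∈used v v∈) y∉used

    f′ : Fin k → Fin n
    f′ = updateAt f w (λ _ → y)

    demand′ : Fin n → ℕ
    demand′ = updateAt (updateAt demand s (_∸ 1)) y (λ _ → Δ ∸ 1)

    f′-new : f′ w ≡ y
    f′-new = updateAt-updates w f

    f′-old : ∀ {u} → dom u ≡ true → f′ u ≡ f u
    f′-old {u} u∈ = updateAt-minimal u w f (∉⇒≢ {X = dom} u∈ w∉)

    f-old≢y : ∀ {u} → dom u ≡ true → f u ≢ y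
    f-old≢y u∈ = ∉⇒≢ {X = used} (f∈used _ u∈) y∉used

    demand′-new : demand′ y ≡ Δ ∸ 1
    demand′-new = updateAt-updates y (updateAt demand s (_∸ 1))

    demand′-s : demand′ s ≡ demand s ∸ 1
    demand′-s = trans (updateAt-minimal s y _ s≢y) (updateAt-updates s demand)

    demand′-other : ∀ {x} → x ≢ y → x ≢ s → demand′ x ≡ demand x
    demand′-other {x} x≢y x≢s = trans (updateAt-minimal x y _ x≢y) (updateAt-minimal x s demand x≢s)

    1≤demand-s : 1 ≤ demand s
    1≤demand-s = 1≤demand P v∈ w∉ vw

    demand-lowered : ∀ x → demand′ x + bit (⁅ s ⁆ x) ≤ demand x
    demand-lowered x with x ≟ y | x ≟ s
    ... | yes refl | yes y≡s = ⊥-elim (s≢y (≡.sym y≡s))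
    ... | yes refl | no _ = begin
      demand′ y + 0    ≡⟨ cong (_+ 0) demand′-new ⟩
      Δ ∸ 1 + 0        ≤⟨ ℕP.≤-trans (ℕP.≤-reflexive (ℕP.+-identityʳ _)) (ℕP.m∸n≤m Δ 1) ⟩
      Δ                ≡⟨ demand-unused y y∉used ⟨
      demand y         ∎
      where open ℕP.≤-Reasoning
    ... | no _ | yes refl = ℕP.≤-reflexive (trans (cong (_+ 1) demand′-s) (ℕP.m∸n+n≡m 1≤demand-s))
    ... | no x≢y | no x≢s = ℕP.≤-reflexive (trans (ℕP.+-identityʳ _) (demand′-other x≢y x≢s))

    -- A neighbour of w in dom other than v would close a cycle through dom.
    new-edge : ∀ a → dom a ≡ true → adj T a w ≡ true → adj G (f a) y ≡ true
    new-edge a a∈ aw with a ≟ v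
    ... | yes refl = sy
    ... | no a≢v   = ⊥-elim (acyclic (PathIn⇒cycle T w∉ (trans (sym T w v) vw) aw
                       (dom-connected v a v∈ a∈ (λ v≡a → a≢v (≡.sym v≡a)))))

    f′-injective : ∀ a c → dom′ a ≡ true → dom′ c ≡ true → f′ a ≡ f′ c → a ≡ c
    f′-injective a c a∈ c∈ fa≡fc with ∪⁅⁆-cases dom a∈ | ∪⁅⁆-cases dom c∈
    ... | inj₁ a∈₀ | inj₁ c∈₀ =
      f-injective a c a∈₀ c∈₀ (trans (≡.sym (f′-old a∈₀)) (trans fa≡fc (f′-old c∈₀)))
    ... | inj₁ a∈₀ | inj₂ refl =
      ⊥-elim (f-old≢y a∈₀ (trans (≡.sym (f′-old a∈₀)) (trans fa≡fc f′-new)))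
    ... | inj₂ refl | inj₁ c∈₀ =
      ⊥-elim (f-old≢y c∈₀ (trans (≡.sym (f′-old c∈₀)) (trans (≡.sym fa≡fc) f′-new)))
    ... | inj₂ refl | inj₂ refl = refl

    f′-edges : ∀ a c → dom′ a ≡ true → dom′ c ≡ true → adj T a c ≡ true → adj G (f′ a) (f′ c) ≡ true
    f′-edges a c a∈ c∈ ac with ∪⁅⁆-cases dom a∈ | ∪⁅⁆-cases dom c∈
    ... | inj₁ a∈₀ | inj₁ c∈₀ rewrite f′-old a∈₀ | f′-old c∈₀ = f-edges a c a∈₀ c∈₀ ac
    ... | inj₁ a∈₀ | inj₂ refl rewrite f′-old a∈₀ | f′-new = new-edge a a∈₀ ac
    ... | inj₂ refl | inj₁ c∈₀ rewrite f′-old c∈₀ | f′-new =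
      trans (sym G y (f c)) (new-edge c c∈₀ (trans (sym T c a) ac))
    ... | inj₂ refl | inj₂ refl = ⊥-elim (true≢false (trans (≡.sym ac) (irrefl T a)))

    f′∈used′ : ∀ u → dom′ u ≡ true → used′ (f′ u) ≡ true
    f′∈used′ u u∈ with ∪⁅⁆-cases dom u∈
    ... | inj₁ u∈₀ rewrite f′-old u∈₀ = ⊆∪⁅⁆ used y (f u) (f∈used u u∈₀)
    ... | inj₂ refl rewrite f′-new = ∪⁅⁆-new used y

    demand′-unused : ∀ x → used′ x ≡ false → demand′ x ≡ Δ
    demand′-unused x x∉ with ∨-false {used x} x∉
    ... | x∉used , x∉y =
      trans (demand′-other (λ { refl → true≢false (trans (≡.sym (⁅⁆-self y)) x∉y) })
                           (∉⇒≢ {X = used} (f∈used v v∈) x∉used ∘ ≡.sym))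
            (demand-unused x x∉used)

    neighbours-of-v : size (dom′ ∩ adj T v) ≡ suc (size (dom ∩ adj T v))
    neighbours-of-v = trans (size-cong pointwise) (size-∪-⁅⁆ (dom ∩ adj T v) (cong (_∧ adj T v w) w∉))
      where
      pointwise : dom′ ∩ adj T v ≐ (dom ∩ adj T v) ∪ ⁅ w ⁆
      pointwise i with i ≟ w
      ... | yes refl rewrite w∉ | vw = refl
      ... | no _ = trans (cong (_∧ adj T v i) (BoolP.∨-identityʳ (dom i))) (≡.sym (BoolP.∨-identityʳ _))

    degree-bound′ : ∀ u → dom′ u ≡ true → size (adj T u) ≤ demand′ (f′ u) + size (dom′ ∩ adj T u)
    degree-bound′ u u∈ with ∪⁅⁆-cases dom u∈
    ... | inj₂ refl = begin
      size (adj T w)                        ≤⟨ max-degree w ⟩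
      Δ                                     ≡⟨ ℕP.m∸n+n≡m 1≤Δ ⟨
      Δ ∸ 1 + 1                             ≤⟨ ℕP.+-monoʳ-≤ (Δ ∸ 1) parent-counted ⟩
      Δ ∸ 1 + size (dom′ ∩ adj T w)
        ≡⟨ cong (_+ size (dom′ ∩ adj T w)) (trans (≡.sym demand′-new) (cong demand′ (≡.sym f′-new))) ⟩
      demand′ (f′ w) + size (dom′ ∩ adj T w) ∎
      where
      open ℕP.≤-Reasoning
      parent-counted : 1 ≤ size (dom′ ∩ adj T w)
      parent-counted = subst (_< size (dom′ ∩ adj T w)) (size-∅ {k})
        (size-mono-< {X = ∅} (λ _ ()) v (cong₂ _∧_ (⊆∪⁅⁆ dom w v v∈) (trans (sym T w v) vw)) refl)
    ... | inj₁ u∈₀ with u ≟ v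
    ...   | yes refl = begin
      size (adj T v)                                ≤⟨ degree-bound v v∈ ⟩
      demand s + size (dom ∩ adj T v)               ≡⟨ cong (_+ size (dom ∩ adj T v)) (ℕP.m∸n+n≡m 1≤demand-s) ⟨
      demand s ∸ 1 + 1 + size (dom ∩ adj T v)       ≡⟨ ℕP.+-assoc (demand s ∸ 1) 1 _ ⟩
      demand s ∸ 1 + suc (size (dom ∩ adj T v))     ≡⟨ cong (demand s ∸ 1 +_) neighbours-of-v ⟨
      demand s ∸ 1 + size (dom′ ∩ adj T v)
        ≡⟨ cong (_+ size (dom′ ∩ adj T v)) (trans (≡.sym demand′-s) (cong demand′ (≡.sym (f′-old v∈)))) ⟩
      demand′ (f′ v) + size (dom′ ∩ adj T v)        ∎
      where open ℕP.≤-Reasoning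
    ...   | no u≢v = begin
      size (adj T u)                                ≤⟨ degree-bound u u∈₀ ⟩
      demand (f u) + size (dom ∩ adj T u)           ≤⟨ ℕP.+-monoʳ-≤ (demand (f u)) (size-mono dom∩⊆) ⟩
      demand (f u) + size (dom′ ∩ adj T u)
        ≡⟨ cong (_+ size (dom′ ∩ adj T u))
                (trans (≡.sym (demand′-other (f-old≢y u∈₀) fu≢s)) (cong demand′ (≡.sym (f′-old u∈₀)))) ⟩
      demand′ (f′ u) + size (dom′ ∩ adj T u)        ∎
      where
      open ℕP.≤-Reasoning
      fu≢s : f u ≢ s
      fu≢s fu≡fv = u≢v (f-injective u v u∈₀ v∈ fu≡fv)
      dom∩⊆ : dom ∩ adj T u ⊆ dom′ ∩ adj T u
      dom∩⊆ x dom∧adj with ∧-true {dom x} dom∧adj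
      ... | x∈ , ux = cong₂ _∧_ (⊆∪⁅⁆ dom w x x∈) ux

    dom′-connected : ∀ a c → dom′ a ≡ true → dom′ c ≡ true → a ≢ c → PathIn T dom′ a c
    dom′-connected a c a∈ c∈ a≢c with ∪⁅⁆-cases dom a∈ | ∪⁅⁆-cases dom c∈
    ... | inj₁ a∈₀ | inj₁ c∈₀ = PathIn-mono T (⊆∪⁅⁆ dom w) (dom-connected a c a∈₀ c∈₀ a≢c)
    ... | inj₂ refl | inj₁ c∈₀ with c ≟ v
    ...   | yes refl = PathIn-edge T a≢c (∪⁅⁆-new dom w) (⊆∪⁅⁆ dom w v v∈) (trans (sym T w v) vw)
    ...   | no c≢v   = PathIn-∷ T w∉ (trans (sym T w v) vw) (dom-connected v c v∈ c∈₀ (c≢v ∘ ≡.sym))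
    dom′-connected a c a∈ c∈ a≢c | inj₁ a∈₀ | inj₂ refl with a ≟ v
    ...   | yes refl = PathIn-edge T a≢c (⊆∪⁅⁆ dom w v v∈) (∪⁅⁆-new dom w) vw
    ...   | no a≢v   = PathIn-∷ʳ T w∉ vw (dom-connected a v a∈₀ v∈ a≢v)
    dom′-connected a c a∈ c∈ a≢c | inj₂ refl | inj₂ refl = ⊥-elim (a≢c refl)

    grown : Partial
    grown = record
      { dom           = dom′
      ; f             = f′
      ; used          = used′
      ; demand        = demand′
      ; root          = root
      ; root∈dom      = ⊆∪⁅⁆ dom w root root∈dom
      ; f-injective   = f′-injective
      ; f-edges       = f′-edges
      ; f∈used        = f′∈used′
      ; size-used     = trans (size-∪-⁅⁆ used y∉used) (trans (cong suc size-used) (≡.sym (size-∪-⁅⁆ dom w∉)))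
      ; demand≤Δ      = λ x → ℕP.≤-trans (ℕP.m≤m+n _ _) (ℕP.≤-trans (demand-lowered x) (demand≤Δ x))
      ; demand-unused = demand′-unused
      ; good          = good-after demand-lowered
      ; degree-bound  = degree-bound′
      ; dom-connected = dom′-connected
      }

  -- The result of `extend` is taken apart by a helper rather than by `with`:
  -- abstracting over that call is prohibitively expensive for the type checker.
  grow-along : (P : Partial) {v w : Fin k} → Partial.dom P v ≡ true → Partial.dom P w ≡ false → adj T v w ≡ true →
               Σ Partial λ P′ → size (Partial.dom P′) ≡ suc (size (Partial.dom P))
  grow-along P {v} v∈ w∉ vw = attach (extend demand≤Δ good (room-left P w∉) (f v) (1≤demand P v∈ w∉ vw))
    where
    open Partial P
    attach : (∃ λ y → used y ≡ false × adj G (f v) y ≡ true ×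
                (∀ {b′} → (∀ x → b′ x + bit (⁅ f v ⁆ x) ≤ demand x) → Good (used ∪ ⁅ y ⁆) b′)) →
             Σ Partial λ P′ → size (Partial.dom P′) ≡ suc (size dom)
    attach (y , y∉used , sy , good-after) = Grow.grown P v∈ w∉ vw y∉used sy good-after , size-∪-⁅⁆ dom w∉

  grow : (P : Partial) → size (Partial.dom P) < k →
         Σ Partial λ P′ → size (Partial.dom P′) ≡ suc (size (Partial.dom P))
  grow P dom<k with size<n⇒∃∉ (Partial.dom P) dom<k
  ... | u , u∉ with walk-leaves T (Partial.dom P) (connected (Partial.root P) u) (Partial.root∈dom P) u∉
  ...   | v , w , v∈ , w∉ , vw = grow-along P v∈ w∉ vw

  complete : (j : ℕ) (P : Partial) → size (Partial.dom P) + j ≡ k → ContainsCopy G T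
  complete zero P dom≡k = f , (λ {a} {c} → f-injective a c (everywhere a) (everywhere c)) ,
                              (λ a c → f-edges a c (everywhere a) (everywhere c))
    where
    open Partial P
    everywhere : ∀ u → dom u ≡ true
    everywhere = size≡n⇒full dom (trans (≡.sym (ℕP.+-identityʳ _)) dom≡k)
  complete (suc j) P dom+j≡k = continue (grow P (subst (size (Partial.dom P) <_) dom+j≡k (ℕP.m<m+n _ (s≤s z≤n))))
    where
    continue : (Σ Partial λ P′ → size (Partial.dom P′) ≡ suc (size (Partial.dom P))) → ContainsCopy G T
    continue (P′ , P′≡) = complete j P′ (trans (cong (_+ j) P′≡) (trans (≡.sym (ℕP.+-suc _ j)) dom+j≡k))

  embed : Fin k → ContainsCopy G T
  embed r = complete (k ∸ 1) (initial r (Fin.inject≤ r (ℕP.≤-trans (ℕP.m≤m+n k _) room)))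
                     (trans (cong (_+ (k ∸ 1)) (size-⁅⁆ r))
                            (ℕP.m+[n∸m]≡n (ℕ.>-nonZero⁻¹ k {{FinP.nonZeroIndex r}})))

-- Graphs of maximum degree at most one

module _ (T : Graph k) where

  degree-positive : {u v : Fin k} → Walk T u v → u ≢ v → 1 ≤ size (adj T u)
  degree-positive here                   u≢u = ⊥-elim (u≢u refl)
  degree-positive (there {w = w} uw _)   _   =
    subst (_< size (adj T _)) (size-∅ {k}) (size-mono-< {X = ∅} (λ _ ()) w uw refl)

  module _ (max-degree≤1 : ∀ u → size (adj T u) ≤ 1) where

    unique-neighbour : ∀ {x y z} → adj T x y ≡ true → adj T x z ≡ true → y ≡ z
    unique-neighbour {x} {y} {z} xy xz with y ≟ z
    ... | yes y≡z = y≡z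
    ... | no y≢z  = ⊥-elim (ℕP.<-irrefl refl (ℕP.≤-trans two≤deg (max-degree≤1 x)))
      where
      pair⊆adj : ⁅ y ⁆ ∪ ⁅ z ⁆ ⊆ adj T x
      pair⊆adj i i∈ with ∪⁅⁆-cases ⁅ y ⁆ {i} {z} i∈
      ... | inj₁ i∈y = subst (λ j → adj T x j ≡ true) (≡.sym (⁅⁆⇒≡ i∈y)) xy
      ... | inj₂ refl = xz
      two≤deg : 2 ≤ size (adj T x)
      two≤deg = subst (_≤ size (adj T x))
                  (trans (size-∪-⁅⁆ ⁅ y ⁆ (≢⇒∉⁅⁆ (y≢z ∘ ≡.sym))) (cong suc (size-⁅⁆ y)))
                  (size-mono pair⊆adj)

    walk-short : {u v : Fin k} → Walk T u v → v ≡ u ⊎ adj T u v ≡ true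
    walk-short here = inj₁ refl
    walk-short {u} (there {w = w} uw walk) with walk-short walk
    ... | inj₁ refl = inj₂ uw
    ... | inj₂ wv   = inj₁ (unique-neighbour wv (trans (sym T w u) uw))

connected-max-degree≤1⇒≤2 : (T : Graph k) → Connected T → (∀ u → size (adj T u) ≤ 1) → k ≤ 2
connected-max-degree≤1⇒≤2 {0}                   T _ _ = z≤n
connected-max-degree≤1⇒≤2 {1}                   T _ _ = s≤s z≤n
connected-max-degree≤1⇒≤2 {2}                   T _ _ = s≤s (s≤s z≤n)
connected-max-degree≤1⇒≤2 {suc (suc (suc k))} T connected max-degree≤1
  with walk-short T max-degree≤1 (connected zero (suc zero)) | walk-short T max-degree≤1 (connected zero (suc (suc zero)))
... | inj₁ () | _
... | inj₂ _  | inj₁ ()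
... | inj₂ a  | inj₂ b with unique-neighbour T max-degree≤1 a b
...   | ()

module _ (G : Graph n) where

  vertex-copy : Fin n → (T : Graph 1) → ContainsCopy G T
  vertex-copy x T = (λ _ → x) , (λ { {zero} {zero} _ → refl }) ,
                    (λ { zero zero tt → ⊥-elim (true≢false (trans (≡.sym tt) (irrefl T zero))) })

  edge-copy : {x y : Fin n} → adj G x y ≡ true → (T : Graph 2) → ContainsCopy G T
  edge-copy {x} {y} xy T = f , injective , edges
    where
    x≢y : x ≢ y
    x≢y refl = true≢false (trans (≡.sym xy) (irrefl G x))
    f : Fin 2 → Fin n
    f zero       = x
    f (suc zero) = y
    injective : ∀ {a c} → f a ≡ f c → a ≡ c
    injective {zero}     {zero}     _ = refl
    injective {zero}     {suc zero} e = ⊥-elim (x≢y e)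
    injective {suc zero} {zero}     e = ⊥-elim (x≢y (≡.sym e))
    injective {suc zero} {suc zero} _ = refl
    edges : ∀ a c → adj T a c ≡ true → adj G (f a) (f c) ≡ true
    edges zero       zero       tt = ⊥-elim (true≢false (trans (≡.sym tt) (irrefl T zero)))
    edges zero       (suc zero) _  = xy
    edges (suc zero) zero       _  = trans (sym G y x) xy
    edges (suc zero) (suc zero) tt = ⊥-elim (true≢false (trans (≡.sym tt) (irrefl T (suc zero))))

  has-edge : {Δ m : ℕ} → Expanding G Δ m → 2 * m ≤ n → ∃₂ λ x y → adj G x y ≡ true
  has-edge {m = m} expanding 2m≤n
    with ⊆-of-size full m (subst (m ≤_) (≡.sym (size-full {n})) (ℕP.≤-trans (ℕP.m≤m+n m _) 2m≤n))
  ... | X , _ , X≡m with size (nbr G X) in N≡ | size-partition G X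
  ...   | zero  | partition = ⊥-elim (ℕP.<-irrefl refl (ℕP.<-≤-trans too-small 2m≤n))
    where
    too-small : n < 2 * m
    too-small = begin-strict
      n                                  ≡⟨ partition ⟨
      size X + 0 + size (exterior G X)   ≡⟨ cong (λ z → z + 0 + size (exterior G X)) X≡m ⟩
      m + 0 + size (exterior G X)
        <⟨ ℕP.+-monoʳ-< (m + 0) (Expanding.exterior-small expanding X (ℕP.≤-reflexive (≡.sym X≡m))) ⟩
      m + 0 + m                          ≡⟨ double m ⟩
      2 * m                              ∎
      where
      open ℕP.≤-Reasoning
      double : ∀ m → m + 0 + m ≡ 2 * m
      double = solve-∀
  ...   | suc _ | _ with nbr-elim G (proj₂ (size-positive (nbr G X) (subst (0 <_) (≡.sym N≡) (s≤s z≤n))))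
  ...     | x , _ , xy = _ , _ , xy

-- From the expander hypotheses

toℚᵘ-ℕ→ℚ : ∀ a → toℚᵘ (ℕ→ℚ a) ≡ ℚᵘ.mkℚᵘ (ℤ.+ a) 0
toℚᵘ-ℕ→ℚ a = cong toℚᵘ (ℚP.normalize-coprime (Coprimality.sym (Coprimality.1-coprimeTo a)))

ℕ→ℚ-*-≤-reflect : ∀ a c N → ℕ→ℚ a ℚ.* ℕ→ℚ c ℚ.≤ ℕ→ℚ N → a * c ≤ N
ℕ→ℚ-*-≤-reflect a c N ac≤N
  with subst₂ ℚᵘ._≤_ (cong₂ ℚᵘ._*_ (toℚᵘ-ℕ→ℚ a) (toℚᵘ-ℕ→ℚ c)) (toℚᵘ-ℕ→ℚ N)
         (ℚᵘP.≤-respˡ-≃ (ℚP.toℚᵘ-homo-* (ℕ→ℚ a) (ℕ→ℚ c)) (ℚP.toℚᵘ-mono-≤ ac≤N))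
... | ℚᵘ.*≤* ac*1≤N*1 =
  ℤP.drop‿+≤+ (subst₂ ℤ._≤_ (trans (ℤP.*-identityʳ _) (≡.sym (ℤP.pos-* a c))) (ℤP.*-identityʳ (ℤ.+ N))
                            ac*1≤N*1)

ℕ→ℚ-scale-≤ : ∀ a c N (d : ℚ) → ℕ→ℚ a ℚ.≤ d → d ℚ.* ℕ→ℚ c ℚ.≤ ℕ→ℚ N → a * c ≤ N
ℕ→ℚ-scale-≤ a c N d a≤d dc≤N =
  ℕ→ℚ-*-≤-reflect a c N
    (ℚP.≤-trans (ℚP.*-monoʳ-≤-nonNeg (ℕ→ℚ c) {{ℚP.normalize-nonNeg c 1}} a≤d) dc≤N)

∣tabulate∣≡size : (X : Sub n) → ∣ tabulate X ∣ ≡ size X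
∣tabulate∣≡size {zero}  X = refl
∣tabulate∣≡size {suc n} X with X zero
... | true  = cong suc (∣tabulate∣≡size (λ i → X (suc i)))
... | false = ∣tabulate∣≡size (λ i → X (suc i))

module _ (G : Graph n) where

  ∣N∣≡size-nbr : (X : Sub n) → ∣ N G (tabulate X) ∣ ≡ size (nbr G X)
  ∣N∣≡size-nbr X =
    trans (∣tabulate∣≡size (nbr G (lookup (tabulate X))))
          (size-cong (nbr-cong G (λ x → lookup∘tabulate X x)))

  tabulate-disjoint : (X Y : Sub n) → (∀ x → X x ≡ true → Y x ≡ true → ⊥) → Disjoint (tabulate X) (tabulate Y)
  tabulate-disjoint X Y disjoint x x∈X x∈Y =
    disjoint x (trans (≡.sym (lookup∘tabulate X x)) ([]=⇒lookup x∈X))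
               (trans (≡.sym (lookup∘tabulate Y x)) ([]=⇒lookup x∈Y))

  edge-between : (X Y : Sub n) → 0 < e G (tabulate X) (tabulate Y) →
                 ∃₂ λ x y → X x ≡ true × Y y ≡ true × adj G x y ≡ true
  edge-between X Y 0<e with sumFin-positive _ 0<e
  ... | x , 0<row
    with size-positive _ (subst (0 <_)
           (∣tabulate∣≡size (λ y → lookup (tabulate X) x ∧ lookup (tabulate Y) y ∧ adj G x y)) 0<row)
  ... | y , x∧y∧xy with ∧-true {lookup (tabulate X) x} x∧y∧xy
  ... | Xx , y∧xy = x , y , trans (≡.sym (lookup∘tabulate X x)) Xx ,
                    trans (≡.sym (lookup∘tabulate Y y)) (proj₁ (∧-true y∧xy)) , proj₂ (∧-true y∧xy)

module _ {G : Graph n} {M : ℕ}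
         (crossing : ∀ (X Y : Subset n) → Disjoint X Y → ∣ X ∣ ≡ M → ∣ Y ∣ ≡ M → 0 < e G X Y) where

  private
    crossing-edge : (A B : Sub n) → (∀ x → A x ≡ true → B x ≡ true → ⊥) → size A ≡ M → size B ≡ M →
                    ∃₂ λ x y → A x ≡ true × B y ≡ true × adj G x y ≡ true
    crossing-edge A B disjoint A≡M B≡M = edge-between G A B
      (crossing (tabulate A) (tabulate B) (tabulate-disjoint G A B disjoint)
                (trans (∣tabulate∣≡size A) A≡M) (trans (∣tabulate∣≡size B) B≡M))

  crossing⇒M-positive : 1 ≤ M
  crossing⇒M-positive = ℕP.n≢0⇒n>0 λ M≡0 →
    case crossing-edge ∅ ∅ (λ _ ()) (trans (size-∅ {n}) (≡.sym M≡0)) (trans (size-∅ {n}) (≡.sym M≡0)) of λ ()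

  crossing⇒exterior-small : ∀ X → M ≤ size X → size (exterior G X) < M
  crossing⇒exterior-small X M≤X with M ℕ.≤? size (exterior G X)
  ... | no M≰E = ℕP.≰⇒> M≰E
  ... | yes M≤E with ⊆-of-size X M M≤X | ⊆-of-size (exterior G X) M M≤E
  ...   | A , A⊆X , A≡M | B , B⊆E , B≡M with crossing-edge A B A∩B≡∅ A≡M B≡M
    where
    A∩B≡∅ : ∀ x → A x ≡ true → B x ≡ true → ⊥
    A∩B≡∅ x Ax Bx = true≢false (trans (≡.sym (A⊆X x Ax)) (exterior⇒∉ G {X = X} (B⊆E x Bx)))
  ...     | a , b , Aa , Bb , ab = ⊥-elim (exterior-isolated G X (B⊆E b Bb) (A⊆X a Aa) ab)

scaled-expansion⇒expansion : {G : Graph n} {Δ M : ℕ} (d : ℚ) → ℕ→ℚ (2 * Δ) ℚ.≤ d →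
  (∀ (X : Subset n) → 1 ≤ ∣ X ∣ → ∣ X ∣ < M → d ℚ.* ℕ→ℚ ∣ X ∣ ℚ.≤ ℕ→ℚ ∣ N G X ∣) →
  ∀ X → 1 ≤ size X → size X < M → 2 * Δ * size X ≤ size (nbr G X)
scaled-expansion⇒expansion {G = G} {Δ} d 2Δ≤d expands X 1≤X X<M =
  ℕ→ℚ-scale-≤ (2 * Δ) (size X) (size (nbr G X)) d 2Δ≤d
    (subst₂ (λ a b → d ℚ.* ℕ→ℚ a ℚ.≤ ℕ→ℚ b) (∣tabulate∣≡size X) (∣N∣≡size-nbr G X)
      (expands (tabulate X) (subst (1 ≤_) (≡.sym (∣tabulate∣≡size X)) 1≤X)
                            (subst (_< _) (≡.sym (∣tabulate∣≡size X)) X<M)))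

expander⇒expanding : {G : Graph n} {Δ : ℕ} (d : ℚ) .{{_ : Positive d}} →
  ℕ→ℚ (2 * Δ) ℚ.≤ d → IsExpander n d G → Expanding G Δ (m n d)
expander⇒expanding {n} {G} {Δ} d 2Δ≤d (expands , crossing) = record
  { m-positive     = crossing⇒M-positive {G = G} {m n d} crossing
  ; expansion      = scaled-expansion⇒expansion {G = G} {Δ} {m n d} d 2Δ≤d expands
  ; exterior-small = crossing⇒exterior-small {G = G} {m n d} crossing
  }

k≡n∸c⇒k+c≤n : ∀ {k n c} → k ≡ n ∸ c → 1 ≤ k → k + c ≤ n
k≡n∸c⇒k+c≤n {k} {n} {c} k≡n∸c 1≤k =
  ℕP.≤-reflexive (trans (cong (_+ c) k≡n∸c) (ℕP.m∸n+n≡m (ℕP.<⇒≤ c<n)))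
  where
  c<n : c < n
  c<n = ℕP.m∸n≢0⇒n<m (λ n∸c≡0 → ℕP.<-irrefl (≡.sym (trans k≡n∸c n∸c≡0)) 1≤k)

nonempty-tree-copy : {G : Graph n} {Δ m : ℕ} → Expanding G Δ m → (T : Graph (suc k)) → suc k + 4 * Δ * m ≤ n →
                     Connected T → ¬ HasCycle T → (∀ u → size (adj T u) ≤ Δ) → ContainsCopy G T
nonempty-tree-copy {n} {k} {G} {Δ} {m} expanding T room connected acyclic max-degree with 2 ℕ.≤? Δ
... | yes 2≤Δ = TreeEmbedding.embed expanding 2≤Δ room connected acyclic max-degree zero
... | no 2≰Δ with connected-max-degree≤1⇒≤2 T connected (λ u → ℕP.≤-trans (max-degree u) Δ≤1)
  where
  Δ≤1 : Δ ≤ 1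
  Δ≤1 = ℕP.≤-pred (ℕP.≰⇒> 2≰Δ)
... | s≤s z≤n = vertex-copy G (Fin.inject≤ zero (ℕP.≤-trans (ℕP.m≤m+n 1 _) room)) T
... | s≤s (s≤s z≤n) with has-edge G expanding 2m≤n
  where
  1≤Δ : 1 ≤ Δ
  1≤Δ = ℕP.≤-trans (degree-positive T (connected zero (suc zero)) (λ ())) (max-degree zero)
  2m≤n : 2 * m ≤ n
  2m≤n = ℕP.≤-trans (ℕP.*-monoˡ-≤ m (ℕP.≤-trans (s≤s (s≤s z≤n)) (ℕP.*-monoʳ-≤ 4 1≤Δ)))
                    (ℕP.≤-trans (ℕP.m≤n+m _ 2) room)
...   | _ , _ , xy = edge-copy G xy T

tree-copy : {G : Graph n} {Δ m : ℕ} → Expanding G Δ m → (T : Graph k) → k ≡ n ∸ 4 * Δ * m →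
            Connected T → ¬ HasCycle T → (∀ u → size (adj T u) ≤ Δ) → ContainsCopy G T
tree-copy {k = zero}  _         T _  _ _ _ = (λ ()) , (λ { {()} }) , (λ ())
tree-copy {k = suc _} expanding T k≡ connected acyclic max-degree =
  nonempty-tree-copy expanding T (k≡n∸c⇒k+c≤n k≡ (s≤s z≤n)) connected acyclic max-degree

corollary3p7 : (n Δ : ℕ) (d : ℚ) .{{_ : Positive d}} →
    ℕ→ℚ (2 * Δ) ℚ.≤ d →
    (G : Graph n) → IsExpander n d G →
    (T : Graph (n ∸ 4 * Δ * m n d)) → IsTree T → MaxDegreeAtMost T Δ →
    ContainsCopy G T
corollary3p7 n Δ d 2Δ≤d G expander T (connected , acyclic) max-degree =
  tree-copy {G = G} {Δ} {m n d} (expander⇒expanding {G = G} {Δ} d 2Δ≤d expander) T refl connected acyclic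
    (λ u → subst (_≤ Δ) (∣tabulate∣≡size (adj T u)) (max-degree u))
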